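{- Let $G=(V,E,w)$ be a finite simple undirected graph with positive vertex weights, let $\{u\}$ be a vertex-cut of size one in $G$, and let $G^*$ be a connected component of $G-u$. (1) If $w(u)+\alpha(G^*-N[u])\le\alpha(G^*)$, then $\alpha(G)=\alpha(G_1)+\alpha(G^*)$, where $G_1$ is the graph obtained from $G$ by removing the vertices of $G^*$ and the vertex $u$. (2) If $w(u)+\alpha(G^*-N[u])>\alpha(G^*)$, then $\alpha(G)=\alpha(G_2)+\alpha(G^*)$, where $G_2$ is the graph obtained from $G$ by removing the vertices of $G^*$ and changing the weight of $u$ to $w(u)+\alpha(G^*-N[u])-\alpha(G^*)$.
   Context: $\alpha(H)$ denotes the maximum total vertex weight of an independent set in the weighted graph $H$ (all subgraphs inherit the weights of $G$ unless stated otherwise). $N[u]$ is the closed neighborhood of $u$ in $G$, and $H-X$ denotes the subgraph of $H$ induced by the vertices of $H$ not in $X$.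
   Formalization: The vertex weights of G are positive rationals. -}

module Defs where

open import Data.Nat using (ℕ; zero; suc)
open import Data.Fin using (Fin; zero; suc; _≟_)
open import Data.Bool using (Bool; true; false; _∧_; not; if_then_else_)
open import Data.List using (List; []; _∷_; [_]; concatMap; foldr)
open import Data.Rational using (ℚ; 0ℚ; _+_; _-_; _⊔_; _≤_; _<_)
open import Relation.Nullary using (does; ¬_)
open import Relation.Binary.PropositionalEquality using (_≡_; _≢_)
open import Data.Product using (Σ; _×_; ∃)

record WGraph (n : ℕ) : Set where
  field
    adj    : Fin n → Fin n → Bool
    sym    : ∀ i j → adj i j ≡ adj j i
    irrefl : ∀ i → adj i i ≡ false
    w      : Fin n → ℚ
    wpos   : ∀ i → 0ℚ < w i
open WGraph public

-- Vertex subsets (induced subgraphs are given by their vertex sets).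
VSet : ℕ → Set
VSet n = Fin n → Bool

allB : ∀ {n} → (Fin n → Bool) → Bool
allB {zero}  p = true
allB {suc n} p = p zero ∧ allB (λ i → p (suc i))

_⇒ᵇ_ : Bool → Bool → Bool
true  ⇒ᵇ b = b
false ⇒ᵇ b = true

isIndepIn : ∀ {n} → (Fin n → Fin n → Bool) → VSet n → VSet n → Bool
isIndepIn E S I =
  allB (λ i → I i ⇒ᵇ S i) ∧
  allB (λ i → allB (λ j → (I i ∧ I j) ⇒ᵇ not (E i j)))

wsum : ∀ {n} → (Fin n → ℚ) → VSet n → ℚ
wsum {zero}  w I = 0ℚ
wsum {suc n} w I =
  (if I zero then w zero else 0ℚ) + wsum (λ i → w (suc i)) (λ i → I (suc i))

cons : ∀ {n} → Bool → VSet n → VSet (suc n)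
cons b s zero    = b
cons b s (suc i) = s i

subsets : (n : ℕ) → List (VSet n)
subsets zero    = [ (λ ()) ]
subsets (suc n) = concatMap (λ s → cons false s ∷ cons true s ∷ []) (subsets n)

α : ∀ {n} → (Fin n → Fin n → Bool) → (Fin n → ℚ) → VSet n → ℚ
α {n} E w S =
  foldr (λ I m → (if isIndepIn E S I then wsum w I else 0ℚ) ⊔ m) 0ℚ (subsets n)

_==_ : ∀ {n} → Fin n → Fin n → Bool
i == j = does (i ≟ j)

full : ∀ {n} → VSet n
full i = true

N[_] : ∀ {n} → (G : WGraph n) → Fin n → VSet n
N[ G ] u i = (i == u) Data.Bool.∨ adj G u i

_∖_ : ∀ {n} → VSet n → VSet n → VSet n
(S ∖ X) i = S i ∧ not (X i)

single : ∀ {n} → Fin n → VSet n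
single u i = i == u

data Reach {n} (E : Fin n → Fin n → Bool) (S : VSet n) : Fin n → Fin n → Set where
  here : ∀ {x} → S x ≡ true → Reach E S x x
  step : ∀ {x y z} → S x ≡ true → E x y ≡ true → Reach E S y z → Reach E S x z

IsCutVertex : ∀ {n} → WGraph n → Fin n → Set
IsCutVertex G u =
  Σ _ λ x → Σ _ λ y → x ≢ u × y ≢ u × ¬ Reach (adj G) (full ∖ single u) x y

IsComponentMinus : ∀ {n} → WGraph n → Fin n → VSet n → Set
IsComponentMinus G u C =
  C u ≡ false ×
  ∃ (λ x → C x ≡ true) ×
  (∀ x y → C x ≡ true → C y ≡ true → Reach (adj G) C x y) ×
  (∀ x y → C x ≡ true → C y ≡ false → y ≢ u → adj G x y ≡ false)

setW : ∀ {n} → (Fin n → ℚ) → Fin n → ℚ → Fin n → ℚ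
setW w u c i = if i == u then c else w i

{-# OPTIONS --safe #-}
-- Branch on the cut vertex u: an independent set of G either avoids u, or
-- contains u and avoids its neighbours, so
--   α(G) = α(G − u) ⊔ (w(u) + α(G − N[u])).
-- Since the only edges between C and the rest of G go through u, both G − u
-- and G − N[u] split into a part inside C and a part outside C with no edges
-- between them, so their α is the sum of the two.  In case (1) the second branch never
-- wins.  In case (2), branching on u inside G₂ as well shows that the new
-- weight of u reproduces exactly the second branch.
module Submission where

open import Defs
open import Data.Nat using (ℕ)
open import Data.Fin using (Fin)
open import Data.Bool using (Bool)
open import Data.Rational using (ℚ; _+_; _-_; _≤_; _<_)
open import Data.Product using (_×_)
open import Relation.Binary.PropositionalEquality using (_≡_)

open import Algebra.Bundles using (CommutativeMonoid)
open import Data.Bool using (true; false; _∧_; _∨_; not; if_then_else_)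
open import Data.Bool.Properties using (∧-zeroʳ; ∧-identityʳ; ∨-identityʳ; ∨-zeroʳ; ∨-conicalʳ)
open import Data.Empty using (⊥; ⊥-elim)
open import Data.Fin using (zero; suc; _≟_)
open import Data.Fin.Properties using (suc-injective)
open import Data.List using (List; []; _∷_; foldr)
open import Data.List.Membership.Propositional using (_∈_)
open import Data.List.Membership.Propositional.Properties using (∈-concatMap⁺)
open import Data.List.Relation.Unary.Any using (here; there)
import Data.List.Relation.Unary.Any as Any
open import Data.Product using (∃; _,_; proj₁; proj₂)
open import Data.Rational using (0ℚ; _⊔_)
open import Data.Rational.Properties
  using ( ≤-reflexive; ≤-trans; ≤-antisym; +-mono-≤; +-monoˡ-≤; +-monoʳ-≤
        ; +-comm; +-identityˡ; +-identityʳ; +-0-commutativeMonoid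
        ; p≤p⊔q; p≤q⊔p; p≤q⇒p≤q⊔r; p≤q⇒p≤r⊔q; ⊔-sel; ⊔-lub; p≥q⇒p⊔q≡p; mono-≤-distrib-⊔
        ; module ≤-Reasoning)
open import Data.Rational.Solver using (module +-*-Solver)
open import Data.Sum using (_⊎_; inj₁; inj₂)
open import Function using (_∘′_)
import Relation.Binary.PropositionalEquality as ≡
open import Relation.Binary.PropositionalEquality using (_≢_; refl; trans; cong; cong₂; module ≡-Reasoning)
open import Relation.Nullary using (yes; no)
open import Relation.Nullary.Decidable using (dec-true; dec-false)

open import Algebra.Properties.CommutativeSemigroup
  (CommutativeMonoid.commutativeSemigroup +-0-commutativeMonoid)
  using (interchange; x∙yz≈xz∙y)

private
  variable
    n : ℕ
    a b : Bool

∧-true⁻ : a ∧ b ≡ true → a ≡ true × b ≡ true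
∧-true⁻ {true} {true} _ = refl , refl

∧-true⁺ : a ≡ true → b ≡ true → a ∧ b ≡ true
∧-true⁺ refl refl = refl

∨-true⁻ : a ∨ b ≡ true → a ≡ true ⊎ b ≡ true
∨-true⁻ {true}          _ = inj₁ refl
∨-true⁻ {false} {true}  _ = inj₂ refl

not-true⁻ : not a ≡ true → a ≡ false
not-true⁻ {false} _ = refl

not-true⁺ : a ≡ false → not a ≡ true
not-true⁺ refl = refl

⇒ᵇ-intro : (a ≡ true → b ≡ true) → (a ⇒ᵇ b) ≡ true
⇒ᵇ-intro {true}  h = h refl
⇒ᵇ-intro {false} h = refl

⇒ᵇ-elim : (a ⇒ᵇ b) ≡ true → a ≡ true → b ≡ true
⇒ᵇ-elim {true} h refl = h

allB-intro : (p : Fin n → Bool) → (∀ i → p i ≡ true) → allB p ≡ true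
allB-intro {ℕ.zero}  p h = refl
allB-intro {ℕ.suc n} p h = ∧-true⁺ (h zero) (allB-intro (λ i → p (suc i)) (λ i → h (suc i)))

allB-elim : (p : Fin n → Bool) → allB p ≡ true → ∀ i → p i ≡ true
allB-elim p h zero    = proj₁ (∧-true⁻ h)
allB-elim p h (suc i) = allB-elim (λ i → p (suc i)) (proj₂ (∧-true⁻ {p zero} h)) i

true≢false : {x : Bool} → x ≡ true → x ≡ false → ⊥
true≢false refl ()

==-refl : (u : Fin n) → (u == u) ≡ true
==-refl u = dec-true (u ≟ u) refl

==-false : {i u : Fin n} → i ≢ u → (i == u) ≡ false
==-false {i = i} {u} = dec-false (i ≟ u)

==-sound : {i u : Fin n} → (i == u) ≡ true → i ≡ u
==-sound {i = i} {u} h with i ≟ u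
... | yes i≡u = i≡u

infix 4 _⊆_ _≐_
infixl 6 _∪_ _∩_

_⊆_ : VSet n → VSet n → Set
S ⊆ T = ∀ {i} → S i ≡ true → T i ≡ true

_≐_ : VSet n → VSet n → Set
S ≐ T = ∀ i → S i ≡ T i

_∪_ : VSet n → VSet n → VSet n
(S ∪ T) i = S i ∨ T i

_∩_ : VSet n → VSet n → VSet n
(S ∩ T) i = S i ∧ T i

Disjoint : VSet n → VSet n → Set
Disjoint S T = ∀ {i} → S i ≡ true → T i ≡ true → ⊥

≐⇒⊆ : {S T : VSet n} → S ≐ T → S ⊆ T
≐⇒⊆ S≐T {i} Si = trans (≡.sym (S≐T i)) Si

≐-sym : {S T : VSet n} → S ≐ T → T ≐ S
≐-sym S≐T i = ≡.sym (S≐T i)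

∖-⊆ : (S X : VSet n) → S ∖ X ⊆ S
∖-⊆ S X {i} h = proj₁ (∧-true⁻ {S i} h)

∖-∉ : (S X : VSet n) {i : Fin n} → (S ∖ X) i ≡ true → X i ≡ false
∖-∉ S X {i} h = not-true⁻ (proj₂ (∧-true⁻ {S i} h))

∖-intro : (S X : VSet n) {i : Fin n} → S i ≡ true → X i ≡ false → (S ∖ X) i ≡ true
∖-intro S X Si Xi = ∧-true⁺ Si (not-true⁺ Xi)

∩-⊆ˡ : (S T : VSet n) → S ∩ T ⊆ S
∩-⊆ˡ S T {i} h = proj₁ (∧-true⁻ {S i} h)

∩-⊆ʳ : (S T : VSet n) → S ∩ T ⊆ T
∩-⊆ʳ S T {i} h = proj₂ (∧-true⁻ {S i} h)

∪-introˡ : (S T : VSet n) → S ⊆ S ∪ T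
∪-introˡ S T {i} Si = cong (_∨ T i) Si

∪-introʳ : (S T : VSet n) → T ⊆ S ∪ T
∪-introʳ S T {i} Ti = trans (cong (S i ∨_) Ti) (∨-zeroʳ (S i))

∪-resolveˡ : (S T : VSet n) {i : Fin n} → (S ∪ T) i ≡ true → S i ≡ false → T i ≡ true
∪-resolveˡ S T {i} h Si = trans (≡.sym (cong (_∨ T i) Si)) h

∉-≢ : (S : VSet n) {i u : Fin n} → S i ≡ true → S u ≡ false → i ≢ u
∉-≢ S Si Su refl = true≢false Si Su

wsum-cong : (v : Fin n → ℚ) {I J : VSet n} → I ≐ J → wsum v I ≡ wsum v J
wsum-cong {ℕ.zero}  v I≐J = refl
wsum-cong {ℕ.suc n} v {J = J} I≐J rewrite I≐J zero =
  cong ((if J zero then v zero else 0ℚ) +_) (wsum-cong (λ i → v (suc i)) (λ i → I≐J (suc i)))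

wsum-cong-weights : (v v′ : Fin n → ℚ) (I : VSet n) →
                    (∀ {i} → I i ≡ true → v i ≡ v′ i) → wsum v I ≡ wsum v′ I
wsum-cong-weights {ℕ.zero}  v v′ I h = refl
wsum-cong-weights {ℕ.suc n} v v′ I h with I zero in I₀
... | true  = cong₂ _+_ (h I₀) (wsum-cong-weights _ _ (λ i → I (suc i)) h)
... | false = cong (0ℚ +_)   (wsum-cong-weights _ _ (λ i → I (suc i)) h)

wsum-empty : (v : Fin n → ℚ) (I : VSet n) → (∀ i → I i ≡ false) → wsum v I ≡ 0ℚ
wsum-empty {ℕ.zero}  v I h = refl
wsum-empty {ℕ.suc n} v I h rewrite h zero =
  trans (+-identityˡ _) (wsum-empty (λ i → v (suc i)) (λ i → I (suc i)) (λ i → h (suc i)))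

wsum-point : (v : Fin n → ℚ) (I : VSet n) (u : Fin n) →
             I u ≡ true → (∀ {i} → i ≢ u → I i ≡ false) → wsum v I ≡ v u
wsum-point v I zero Iu h rewrite Iu =
  trans (cong (v zero +_) (wsum-empty (λ i → v (suc i)) (λ i → I (suc i)) (λ i → h λ ())))
        (+-identityʳ (v zero))
wsum-point v I (suc u) Iu h rewrite h {zero} (λ ()) =
  trans (+-identityˡ _)
        (wsum-point (λ i → v (suc i)) (λ i → I (suc i)) u Iu (λ i≢u → h (λ e → i≢u (suc-injective e))))

if-split : ∀ a p (x : ℚ) →
           (if a then x else 0ℚ) ≡ (if a ∧ p then x else 0ℚ) + (if a ∧ not p then x else 0ℚ)
if-split true  true  x = ≡.sym (+-identityʳ x)
if-split true  false x = ≡.sym (+-identityˡ x)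
if-split false p     x = ≡.sym (+-identityˡ 0ℚ)

wsum-split : (v : Fin n → ℚ) (I P : VSet n) → wsum v I ≡ wsum v (I ∩ P) + wsum v (I ∖ P)
wsum-split {ℕ.zero}  v I P = ≡.sym (+-identityˡ 0ℚ)
wsum-split {ℕ.suc n} v I P =
  trans (cong₂ _+_ (if-split (I zero) (P zero) (v zero)) (wsum-split v⁺ I⁺ P⁺))
        (interchange (if I zero ∧ P zero then v zero else 0ℚ) (if I zero ∧ not (P zero) then v zero else 0ℚ)
                     (wsum v⁺ (I⁺ ∩ P⁺)) (wsum v⁺ (I⁺ ∖ P⁺)))
  where
  v⁺ : Fin n → ℚ
  v⁺ i = v (suc i)
  I⁺ P⁺ : VSet n
  I⁺ i = I (suc i)
  P⁺ i = P (suc i)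

wsum-pivot : (v : Fin n → ℚ) (I : VSet n) (u : Fin n) →
             I u ≡ true → wsum v I ≡ v u + wsum v (I ∖ single u)
wsum-pivot v I u Iu =
  trans (wsum-split v I (single u))
        (cong (_+ wsum v (I ∖ single u)) (wsum-point v (I ∩ single u) u (∧-true⁺ Iu (==-refl u)) off-u))
  where
  off-u : ∀ {i} → i ≢ u → I i ∧ (i == u) ≡ false
  off-u {i} i≢u = trans (cong (I i ∧_) (==-false i≢u)) (∧-zeroʳ (I i))

wsum-∪ : (v : Fin n → ℚ) {J K : VSet n} → Disjoint J K → wsum v (J ∪ K) ≡ wsum v J + wsum v K
wsum-∪ v {J} {K} J∩K=∅ =
  trans (wsum-split v (J ∪ K) J) (cong₂ _+_ (wsum-cong v absorb) (wsum-cong v residue))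
  where
  absorb : (J ∪ K) ∩ J ≐ J
  absorb i with J i
  ... | true  = refl
  ... | false = ∧-zeroʳ (K i)
  residue : (J ∪ K) ∖ J ≐ K
  residue i with J i in Ji | K i in Ki
  ... | true  | true  = ⊥-elim (J∩K=∅ Ji Ki)
  ... | true  | false = refl
  ... | false | k     = ∧-identityʳ k

Independent : (Fin n → Fin n → Bool) → VSet n → VSet n → Set
Independent E S I = I ⊆ S × (∀ {i j} → I i ≡ true → I j ≡ true → E i j ≡ false)

module _ (E : Fin n → Fin n → Bool) where

  isIndepIn-sound : (S I : VSet n) → isIndepIn E S I ≡ true → Independent E S I
  isIndepIn-sound S I h with ∧-true⁻ {allB (λ i → I i ⇒ᵇ S i)} h
  ... | inside , noEdge =
    (λ {i} → ⇒ᵇ-elim (allB-elim _ inside i)) ,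
    (λ {i} {j} Ii Ij → not-true⁻ (⇒ᵇ-elim (allB-elim _ (allB-elim _ noEdge i) j) (∧-true⁺ Ii Ij)))

  isIndepIn-complete : (S I : VSet n) → Independent E S I → isIndepIn E S I ≡ true
  isIndepIn-complete S I (I⊆S , noEdge) =
    ∧-true⁺ (allB-intro _ (λ i → ⇒ᵇ-intro (I⊆S {i})))
            (allB-intro _ λ i → allB-intro _ λ j → ⇒ᵇ-intro λ IiIj →
               not-true⁺ (noEdge {i} {j} (proj₁ (∧-true⁻ IiIj)) (proj₂ (∧-true⁻ {I i} IiIj))))

  Independent-⊆ : {S T I J : VSet n} → J ⊆ I → J ⊆ T → Independent E S I → Independent E T J
  Independent-⊆ J⊆I J⊆T (_ , noEdge) = J⊆T , λ Ji Jj → noEdge (J⊆I Ji) (J⊆I Jj)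

  Independent-∅ : (S : VSet n) → Independent E S (λ _ → false)
  Independent-∅ S = (λ ()) , λ ()

foldr-⊔-upper : {A : Set} (g : A → ℚ) (L : List A) {x : A} → x ∈ L → g x ≤ foldr (λ I m → g I ⊔ m) 0ℚ L
foldr-⊔-upper g (y ∷ L) (here refl) = p≤p⊔q (g y) _
foldr-⊔-upper g (y ∷ L) (there x∈L) = ≤-trans (foldr-⊔-upper g L x∈L) (p≤q⊔p (g y) _)

foldr-⊔-attained : {A : Set} (g : A → ℚ) (L : List A) →
  foldr (λ I m → g I ⊔ m) 0ℚ L ≡ 0ℚ ⊎ ∃ λ x → foldr (λ I m → g I ⊔ m) 0ℚ L ≡ g x
foldr-⊔-attained g []      = inj₁ refl
foldr-⊔-attained g (y ∷ L) with ⊔-sel (g y) (foldr (λ I m → g I ⊔ m) 0ℚ L) | foldr-⊔-attained g L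
... | inj₁ max≡gy | _                 = inj₂ (y , max≡gy)
... | inj₂ max≡m  | inj₁ m≡0          = inj₁ (trans max≡m m≡0)
... | inj₂ max≡m  | inj₂ (x , m≡gx)   = inj₂ (x , trans max≡m m≡gx)

subsets-complete : ∀ n (I : VSet n) → ∃ λ I′ → I′ ∈ subsets n × I ≐ I′
subsets-complete ℕ.zero    I = (λ ()) , here refl , λ ()
subsets-complete (ℕ.suc n) I with subsets-complete n (λ i → I (suc i))
... | I′ , I′∈ , I≐I′ = cons (I zero) I′ , ∈-concatMap⁺ _ (Any.map extend I′∈) , pointwise
  where
  extend : ∀ {s} → I′ ≡ s → cons (I zero) I′ ∈ (cons false s ∷ cons true s ∷ [])
  extend refl with I zero
  ... | false = here refl
  ... | true  = there (here refl)
  pointwise : I ≐ cons (I zero) I′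
  pointwise zero    = refl
  pointwise (suc i) = I≐I′ i

module _ (E : Fin n → Fin n → Bool) (v : Fin n → ℚ) where

  private
    score : VSet n → VSet n → ℚ
    score S I = if isIndepIn E S I then wsum v I else 0ℚ

  α-upper : (S I : VSet n) → Independent E S I → wsum v I ≤ α E v S
  α-upper S I indep with subsets-complete n I
  ... | I′ , I′∈ , I≐I′ = begin
      wsum v I    ≡⟨ wsum-cong v I≐I′ ⟩
      wsum v I′   ≡⟨ cong (if_then wsum v I′ else 0ℚ) (≡.sym I′-indep) ⟩
      score S I′  ≤⟨ foldr-⊔-upper (score S) (subsets n) I′∈ ⟩
      α E v S     ∎
    where
    open ≤-Reasoning
    I′⊆I : I′ ⊆ I
    I′⊆I = ≐⇒⊆ (≐-sym I≐I′)
    I′-indep : isIndepIn E S I′ ≡ true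
    I′-indep = isIndepIn-complete E S I′ (Independent-⊆ E I′⊆I (proj₁ indep ∘′ I′⊆I) indep)

  α-attained : (S : VSet n) → ∃ λ I → Independent E S I × α E v S ≡ wsum v I
  α-attained S with foldr-⊔-attained (score S) (subsets n)
  ... | inj₁ α≡0 = (λ _ → false) , Independent-∅ E S , trans α≡0 (≡.sym (wsum-empty v _ λ _ → refl))
  ... | inj₂ (I , α≡score) with isIndepIn E S I in indep
  ...   | true  = I , isIndepIn-sound E S I indep , α≡score
  ...   | false = (λ _ → false) , Independent-∅ E S , trans α≡score (≡.sym (wsum-empty v _ λ _ → refl))

  α-mono : {S T : VSet n} → S ⊆ T → α E v S ≤ α E v T
  α-mono {S} {T} S⊆T with α-attained S
  ... | I , indep , α≡ = ≤-trans (≤-reflexive α≡)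
                                  (α-upper T I (Independent-⊆ E (λ Ii → Ii) (S⊆T ∘′ proj₁ indep) indep))

  α-cong : {S T : VSet n} → S ≐ T → α E v S ≡ α E v T
  α-cong S≐T = ≤-antisym (α-mono (≐⇒⊆ S≐T)) (α-mono (≐⇒⊆ (≐-sym S≐T)))

α-≤-weights : (E : Fin n → Fin n → Bool) (v v′ : Fin n → ℚ) (S : VSet n) →
              (∀ {i} → S i ≡ true → v i ≡ v′ i) → α E v S ≤ α E v′ S
α-≤-weights E v v′ S v≡v′ with α-attained E v S
... | I , indep , α≡ =
  ≤-trans (≤-reflexive (trans α≡ (wsum-cong-weights v v′ I (v≡v′ ∘′ proj₁ indep))))
          (α-upper E v′ S I indep)

α-cong-weights : (E : Fin n → Fin n → Bool) (v v′ : Fin n → ℚ) (S : VSet n) →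
                 (∀ {i} → S i ≡ true → v i ≡ v′ i) → α E v S ≡ α E v′ S
α-cong-weights E v v′ S v≡v′ =
  ≤-antisym (α-≤-weights E v v′ S v≡v′) (α-≤-weights E v′ v S (≡.sym ∘′ v≡v′))

module _ (G : WGraph n) (v : Fin n → ℚ) where

  private
    E : Fin n → Fin n → Bool
    E = adj G
    A : VSet n → ℚ
    A = α E v

  Independent-∪ : {S J K : VSet n} → Independent E S J → Independent E S K →
                  (∀ {i j} → J i ≡ true → K j ≡ true → E i j ≡ false) → Independent E S (J ∪ K)
  Independent-∪ {S} {J} {K} (J⊆S , J-noEdge) (K⊆S , K-noEdge) cross = ⊆S , noEdge
    where
    ⊆S : J ∪ K ⊆ S
    ⊆S {i} h with ∨-true⁻ {J i} h
    ... | inj₁ Ji = J⊆S Ji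
    ... | inj₂ Ki = K⊆S Ki
    noEdge : ∀ {i j} → (J ∪ K) i ≡ true → (J ∪ K) j ≡ true → E i j ≡ false
    noEdge {i} {j} hi hj with ∨-true⁻ {J i} hi | ∨-true⁻ {J j} hj
    ... | inj₁ Ji | inj₁ Jj = J-noEdge Ji Jj
    ... | inj₁ Ji | inj₂ Kj = cross Ji Kj
    ... | inj₂ Ki | inj₁ Jj = trans (WGraph.sym G i j) (cross Jj Ki)
    ... | inj₂ Ki | inj₂ Kj = K-noEdge Ki Kj

  α-∪ : {S T : VSet n} → Disjoint S T → (∀ {i j} → S i ≡ true → T j ≡ true → E i j ≡ false) →
        A (S ∪ T) ≡ A S + A T
  α-∪ {S} {T} S∩T=∅ cross = ≤-antisym upper lower
    where
    open ≤-Reasoning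
    upper : A (S ∪ T) ≤ A S + A T
    upper with α-attained E v (S ∪ T)
    ... | I , indep , α≡ = begin
      A (S ∪ T)                          ≡⟨ trans α≡ (wsum-split v I S) ⟩
      wsum v (I ∩ S) + wsum v (I ∖ S)    ≤⟨ +-mono-≤ (α-upper E v S _ I∩S-indep) (α-upper E v T _ I∖S-indep) ⟩
      A S + A T                          ∎
      where
      I∩S-indep : Independent E S (I ∩ S)
      I∩S-indep = Independent-⊆ E (∩-⊆ˡ I S) (∩-⊆ʳ I S) indep
      I∖S⊆T : I ∖ S ⊆ T
      I∖S⊆T h = ∪-resolveˡ S T (proj₁ indep (∖-⊆ I S h)) (∖-∉ I S h)
      I∖S-indep : Independent E T (I ∖ S)
      I∖S-indep = Independent-⊆ E (∖-⊆ I S) I∖S⊆T indep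
    lower : A S + A T ≤ A (S ∪ T)
    lower with α-attained E v S | α-attained E v T
    ... | J , J-indep , αS≡ | K , K-indep , αT≡ = begin
      A S + A T            ≡⟨ cong₂ _+_ αS≡ αT≡ ⟩
      wsum v J + wsum v K  ≡⟨ ≡.sym (wsum-∪ v (λ Ji Ki → S∩T=∅ (proj₁ J-indep Ji) (proj₁ K-indep Ki))) ⟩
      wsum v (J ∪ K)       ≤⟨ α-upper E v (S ∪ T) (J ∪ K) (Independent-∪ J′ K′ J-K-noEdge) ⟩
      A (S ∪ T)            ∎
      where
      J′ : Independent E (S ∪ T) J
      J′ = Independent-⊆ E (λ Ji → Ji) (λ Ji → ∪-introˡ S T (proj₁ J-indep Ji)) J-indep
      K′ : Independent E (S ∪ T) K
      K′ = Independent-⊆ E (λ Ki → Ki) (λ Ki → ∪-introʳ S T (proj₁ K-indep Ki)) K-indep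
      J-K-noEdge : ∀ {i j} → J i ≡ true → K j ≡ true → E i j ≡ false
      J-K-noEdge Ji Kj = cross (proj₁ J-indep Ji) (proj₁ K-indep Kj)

  α-pivot : {S : VSet n} {u : Fin n} → S u ≡ true →
            A S ≡ A (S ∖ single u) ⊔ (v u + A (S ∖ N[ G ] u))
  α-pivot {S} {u} Su = ≤-antisym upper lower
    where
    open ≤-Reasoning
    upper : A S ≤ A (S ∖ single u) ⊔ (v u + A (S ∖ N[ G ] u))
    upper with α-attained E v S
    ... | I , indep , α≡ with I u in Iu
    ... | false = p≤q⇒p≤q⊔r (v u + A (S ∖ N[ G ] u)) (begin
      A S                  ≡⟨ α≡ ⟩
      wsum v I             ≤⟨ α-upper E v _ I (Independent-⊆ E (λ Ii → Ii) I⊆S-u indep) ⟩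
      A (S ∖ single u)     ∎)
      where
      I⊆S-u : I ⊆ S ∖ single u
      I⊆S-u Ii = ∖-intro S (single u) (proj₁ indep Ii) (==-false (∉-≢ I Ii Iu))
    ... | true = p≤q⇒p≤r⊔q (A (S ∖ single u)) (begin
      A S                               ≡⟨ trans α≡ (wsum-pivot v I u Iu) ⟩
      v u + wsum v (I ∖ single u)       ≤⟨ +-monoʳ-≤ (v u) (α-upper E v _ _ I-u-indep) ⟩
      v u + A (S ∖ N[ G ] u)            ∎)
      where
      I-u⊆S-N : I ∖ single u ⊆ S ∖ N[ G ] u
      I-u⊆S-N h = ∖-intro S (N[ G ] u) (proj₁ indep Ii) (cong₂ _∨_ (∖-∉ I (single u) h) (proj₂ indep Iu Ii))
        where Ii = ∖-⊆ I (single u) h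
      I-u-indep : Independent E (S ∖ N[ G ] u) (I ∖ single u)
      I-u-indep = Independent-⊆ E (∖-⊆ I (single u)) I-u⊆S-N indep
    lower : A (S ∖ single u) ⊔ (v u + A (S ∖ N[ G ] u)) ≤ A S
    lower = ⊔-lub (α-mono E v (∖-⊆ S (single u))) (with-u (α-attained E v (S ∖ N[ G ] u)))
      where
      with-u : (∃ λ J → Independent E (S ∖ N[ G ] u) J × A (S ∖ N[ G ] u) ≡ wsum v J) →
               v u + A (S ∖ N[ G ] u) ≤ A S
      with-u (J , J-indep , α≡) = begin
        v u + A (S ∖ N[ G ] u)          ≡⟨ cong₂ _+_ (≡.sym (wsum-point v (single u) u (==-refl u) ==-false)) α≡ ⟩
        wsum v (single u) + wsum v J    ≡⟨ ≡.sym (wsum-∪ v (λ {i} i=u Ji → u∉J (==-sound i=u) Ji)) ⟩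
        wsum v (single u ∪ J)           ≤⟨ α-upper E v S _ (Independent-∪ u-indep J-in-S u-J-noEdge) ⟩
        A S                             ∎
        where
        J∌N : ∀ {i} → J i ≡ true → N[ G ] u i ≡ false
        J∌N Ji = ∖-∉ S (N[ G ] u) (proj₁ J-indep Ji)
        u∉J : ∀ {i} → i ≡ u → J i ≡ true → ⊥
        u∉J refl Ju = true≢false (cong (_∨ adj G u u) (==-refl u)) (J∌N Ju)
        u-indep : Independent E S (single u)
        u-indep = (λ i=u → trans (cong S (==-sound i=u)) Su) ,
                  λ {i} {j} i=u j=u → trans (cong₂ E (==-sound i=u) (==-sound j=u)) (WGraph.irrefl G u)
        J-in-S : Independent E S J
        J-in-S = Independent-⊆ E (λ Ji → Ji) (λ Ji → ∖-⊆ S (N[ G ] u) (proj₁ J-indep Ji)) J-indep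
        u-J-noEdge : ∀ {i j} → single u i ≡ true → J j ≡ true → E i j ≡ false
        u-J-noEdge {i} {j} i=u Jj = trans (cong (λ k → E k j) (==-sound i=u)) (∨-conicalʳ (j == u) _ (J∌N Jj))

setW-at : (v : Fin n → ℚ) (u : Fin n) (c : ℚ) → setW v u c u ≡ c
setW-at v u c = cong (if_then c else v u) (==-refl u)

setW-≢ : (v : Fin n → ℚ) (u : Fin n) (c : ℚ) {i : Fin n} → i ≢ u → setW v u c i ≡ v i
setW-≢ v u c {i} i≢u = cong (if_then c else v i) (==-false i≢u)

module _ (G : WGraph n) (u : Fin n) (C : VSet n) (u∉C : C u ≡ false)
         (sep : ∀ x y → C x ≡ true → C y ≡ false → y ≢ u → adj G x y ≡ false) where

  private
    A : VSet n → ℚ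
    A = α (adj G) (w G)
    Nᵤ : VSet n
    Nᵤ = N[ G ] u
    Rest : VSet n
    Rest = full ∖ C

  outside-C : {X : VSet n} → X u ≡ true → ∀ {i} → (Rest ∖ X) i ≡ true → C i ≡ false × i ≢ u
  outside-C {X} Xu h = ∖-∉ full C (∖-⊆ Rest X h) , λ { refl → true≢false Xu (∖-∉ Rest X h) }

  u∈Nᵤ : Nᵤ u ≡ true
  u∈Nᵤ = cong (_∨ adj G u u) (==-refl u)

  α-∪-across : {X T : VSet n} → X u ≡ true → T ⊆ C → A ((Rest ∖ X) ∪ T) ≡ A (Rest ∖ X) + A T
  α-∪-across Xu T⊆C = α-∪ G (w G)
    (λ Si Ti → true≢false (T⊆C Ti) (proj₁ (outside-C Xu Si)))
    (λ {i} {j} Si Tj → trans (WGraph.sym G i j)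
                             (sep j i (T⊆C Tj) (proj₁ (outside-C Xu Si)) (proj₂ (outside-C Xu Si))))

  full-u≐ : full ∖ single u ≐ (Rest ∖ single u) ∪ C
  full-u≐ i with C i in Ci
  ... | false = ≡.sym (∨-identityʳ _)
  ... | true  = cong not (==-false (∉-≢ C Ci u∉C))

  full-Nᵤ≐ : full ∖ Nᵤ ≐ (Rest ∖ Nᵤ) ∪ (C ∖ Nᵤ)
  full-Nᵤ≐ i with C i
  ... | false = ≡.sym (∨-identityʳ _)
  ... | true  = refl

  α-full : A full ≡ (A (Rest ∖ single u) + A C) ⊔ (w G u + (A (Rest ∖ Nᵤ) + A (C ∖ Nᵤ)))
  α-full = begin
    A full                                         ≡⟨ α-pivot G (w G) {full} refl ⟩
    A (full ∖ single u) ⊔ (w G u + A (full ∖ Nᵤ))  ≡⟨ cong₂ (λ x y → x ⊔ (w G u + y)) split-u split-Nᵤ ⟩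
    (A (Rest ∖ single u) + A C) ⊔ (w G u + (A (Rest ∖ Nᵤ) + A (C ∖ Nᵤ))) ∎
    where
    open ≡-Reasoning
    split-u : A (full ∖ single u) ≡ A (Rest ∖ single u) + A C
    split-u = trans (α-cong (adj G) (w G) full-u≐) (α-∪-across (==-refl u) (λ Ci → Ci))
    split-Nᵤ : A (full ∖ Nᵤ) ≡ A (Rest ∖ Nᵤ) + A (C ∖ Nᵤ)
    split-Nᵤ = trans (α-cong (adj G) (w G) full-Nᵤ≐) (α-∪-across u∈Nᵤ (∖-⊆ C Nᵤ))

  α-full-if-u-unprofitable : w G u + A (C ∖ Nᵤ) ≤ A C → A full ≡ A (Rest ∖ single u) + A C
  α-full-if-u-unprofitable u-unprofitable = trans α-full (p≥q⇒p⊔q≡p (begin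
    w G u + (A (Rest ∖ Nᵤ) + A (C ∖ Nᵤ))   ≡⟨ x∙yz≈xz∙y (w G u) (A (Rest ∖ Nᵤ)) (A (C ∖ Nᵤ)) ⟩
    (w G u + A (C ∖ Nᵤ)) + A (Rest ∖ Nᵤ)   ≤⟨ +-mono-≤ u-unprofitable (α-mono (adj G) (w G) Rest-Nᵤ⊆Rest-u) ⟩
    A C + A (Rest ∖ single u)              ≡⟨ +-comm (A C) (A (Rest ∖ single u)) ⟩
    A (Rest ∖ single u) + A C              ∎))
    where
    open ≤-Reasoning
    Rest-Nᵤ⊆Rest-u : Rest ∖ Nᵤ ⊆ Rest ∖ single u
    Rest-Nᵤ⊆Rest-u h = ∖-intro Rest (single u) (∖-⊆ Rest Nᵤ h) (==-false (proj₂ (outside-C u∈Nᵤ h)))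

  α-full-by-reweighting : A full ≡ α (adj G) (setW (w G) u (w G u + A (C ∖ Nᵤ) - A C)) Rest + A C
  α-full-by-reweighting = begin
    A full                                               ≡⟨ α-full ⟩
    (A (Rest ∖ single u) + A C) ⊔ (w G u + (A (Rest ∖ Nᵤ) + A (C ∖ Nᵤ)))
      ≡⟨ cong ((A (Rest ∖ single u) + A C) ⊔_) (rebalance (w G u) (A (C ∖ Nᵤ)) (A C) (A (Rest ∖ Nᵤ))) ⟩
    (A (Rest ∖ single u) + A C) ⊔ ((c + A (Rest ∖ Nᵤ)) + A C)
      ≡⟨ ≡.sym (mono-≤-distrib-⊔ (+-monoˡ-≤ (A C)) (A (Rest ∖ single u)) (c + A (Rest ∖ Nᵤ))) ⟩
    (A (Rest ∖ single u) ⊔ (c + A (Rest ∖ Nᵤ))) + A C   ≡⟨ cong (_+ A C) (≡.sym α′-Rest) ⟩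
    A′ Rest + A C                                        ∎
    where
    open ≡-Reasoning
    open +-*-Solver using (solve; _:+_; _:-_; _:=_)
    c : ℚ
    c = w G u + A (C ∖ Nᵤ) - A C
    w′ : Fin n → ℚ
    w′ = setW (w G) u c
    A′ : VSet n → ℚ
    A′ = α (adj G) w′
    rebalance : ∀ wu acn ac x → wu + (x + acn) ≡ ((wu + acn - ac) + x) + ac
    rebalance = solve 4 (λ wu acn ac x → wu :+ (x :+ acn) := ((wu :+ acn :- ac) :+ x) :+ ac) refl
    reweight-away-from-u : {X : VSet n} → X u ≡ true → A′ (Rest ∖ X) ≡ A (Rest ∖ X)
    reweight-away-from-u Xu =
      α-cong-weights (adj G) w′ (w G) _ (λ h → setW-≢ (w G) u c (proj₂ (outside-C Xu h)))
    α′-Rest : A′ Rest ≡ A (Rest ∖ single u) ⊔ (c + A (Rest ∖ Nᵤ))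
    α′-Rest = trans (α-pivot G w′ {Rest} (cong not u∉C))
                    (cong₂ _⊔_ (reweight-away-from-u (==-refl u))
                               (cong₂ _+_ (setW-at (w G) u c) (reweight-away-from-u u∈Nᵤ)))

lemma9 : ∀ {n} (G : WGraph n) (u : Fin n) (C : VSet n) →
    IsCutVertex G u →
    IsComponentMinus G u C →
    ((w G u + α (adj G) (w G) (C ∖ N[ G ] u) ≤ α (adj G) (w G) C →
        α (adj G) (w G) full
          ≡ α (adj G) (w G) ((full ∖ C) ∖ single u) + α (adj G) (w G) C)
     ×
     (α (adj G) (w G) C < w G u + α (adj G) (w G) (C ∖ N[ G ] u) →
        α (adj G) (w G) full
          ≡ α (adj G)
              (setW (w G) u (w G u + α (adj G) (w G) (C ∖ N[ G ] u) - α (adj G) (w G) C))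
              (full ∖ C)
            + α (adj G) (w G) C))
lemma9 G u C _ (u∉C , _ , _ , sep) =
  α-full-if-u-unprofitable G u C u∉C sep , λ _ → α-full-by-reweighting G u C u∉C sep
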